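{- Maehara interpolation in $\mathbf{LK}^-$ (cut-free $\mathbf{LK}$) is not complete: there exist a valid implication $A\to B$ and an interpolant $C$ of $A\to B$ such that for no $\mathbf{LK}^-$ proof $\pi$ of the split sequent $A;\Rightarrow;B$ is $\mathcal{M}(\pi)$ logically equivalent to $C$.
   Context: Propositional formulas are built from propositional atoms and the constant $\bot$ using $\wedge,\vee,\neg$; $A\to B$ abbreviates $\neg A\vee B$ and $\top$ abbreviates $\bot\to\bot$. $V(A)$ is the set of atoms occurring in $A$ (with $V(\bot)=\emptyset$); for a multiset $\Gamma$, $V(\Gamma)=\bigcup_{\gamma\in\Gamma}V(\gamma)$. An interpolant of a valid implication $A\to B$ is a formula $C$ with $V(C)\subseteq V(A)\cap V(B)$ such that $A\to C$ and $C\to B$ are valid. A sequent $\Gamma\Rightarrow\Delta$ consists of finite multisets of formulas. The calculus $\mathbf{LK}$ has axioms $p\Rightarrow p$ ($p$ an atom) and $\bot\Rightarrow$, and the rules: left/right weakening ($\Gamma\Rightarrow\Delta$ / $A,\Gamma\Rightarrow\Delta$, resp. $\Gamma\Rightarrow\Delta,A$); left/right contraction ($A,A,\Gamma\Rightarrow\Delta$ / $A,\Gamma\Rightarrow\Delta$ and dually); $(L\wedge_1)$: $A,\Gamma\Rightarrow\Delta$ / $A\wedge B,\Gamma\Rightarrow\Delta$; $(L\wedge_2)$: $B,\Gamma\Rightarrow\Delta$ / $A\wedge B,\Gamma\Rightarrow\Delta$; $(R\wedge)$: $\Gamma\Rightarrow\Delta,A$ and $\Gamma\Rightarrow\Delta,B$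 / $\Gamma\Rightarrow\Delta,A\wedge B$; $(R\vee_1)$: $\Gamma\Rightarrow\Delta,A$ / $\Gamma\Rightarrow\Delta,A\vee B$; $(R\vee_2)$: $\Gamma\Rightarrow\Delta,B$ / $\Gamma\Rightarrow\Delta,A\vee B$; $(L\vee)$: $A,\Gamma\Rightarrow\Delta$ and $B,\Gamma\Rightarrow\Delta$ / $A\vee B,\Gamma\Rightarrow\Delta$; $(L\neg)$: $\Gamma\Rightarrow\Delta,A$ / $\neg A,\Gamma\Rightarrow\Delta$; $(R\neg)$: $A,\Gamma\Rightarrow\Delta$ / $\Gamma\Rightarrow\Delta,\neg A$; cut: $\Gamma\Rightarrow\Delta,A$ and $A,\Gamma\Rightarrow\Delta$ / $\Gamma\Rightarrow\Delta$. $\mathbf{LK}^-$ is $\mathbf{LK}$ without cut. A split sequent $\Gamma_1;\Gamma_2\Rightarrow\Delta_1;\Delta_2$ is the sequent $\Gamma_1,\Gamma_2\Rightarrow\Delta_1,\Delta_2$ with its formulas divided into a left side ($\Gamma_1,\Delta_1$) and a right side ($\Gamma_2,\Delta_2$). A proof of a split sequent is a proof of the underlying sequent in which every sequent is split so that context formulas keep their side and the auxiliary formulas of each rule are on the same side as its main formula. The Maehara interpolant $\mathcal{M}(\pi)$ is defined recursively: for axioms, $p;\Rightarrow p;$ gives $\bot$, $;p\Rightarrow;p$ gives $\top$, $p;\Rightarrow;p$ gives $p$, $;p\Rightarrow p;$ gives $\neg p$, $\bot;\Rightarrow;$ gives $\bot$, $;\bot\Rightarrow;$ gives $\top$; for a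 unary rule, $\mathcal{M}$ of the conclusion equals $\mathcal{M}$ of the premise; for a binary rule with premise proofs $\pi_1,\pi_2$, $\mathcal{M}(\pi)=\mathcal{M}(\pi_1)\vee\mathcal{M}(\pi_2)$ if its main formula is on the left side and $\mathcal{M}(\pi_1)\wedge\mathcal{M}(\pi_2)$ if it is on the right side. Maehara interpolation in a calculus $G$ is complete if for every valid implication $A\to B$ and every interpolant $C$ of it there is a $G$-proof $\pi$ of $A;\Rightarrow;B$ with $\mathcal{M}(\pi)$ logically equivalent to $C$. -}

module Defs where

open import Data.Nat using (ℕ)
open import Data.Bool using (Bool; true; false; _∧_; _∨_; not)
open import Data.List using (List; []; _∷_; _++_)
open import Data.List.Membership.Propositional using (_∈_)
open import Data.List.Relation.Binary.Permutation.Propositional using (_↭_)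
open import Data.Product using (_×_)
open import Relation.Binary.PropositionalEquality using (_≡_)

data Formula : Set where
  atom : ℕ → Formula
  ⊥f   : Formula
  _∧f_ : Formula → Formula → Formula
  _∨f_ : Formula → Formula → Formula
  ¬f_  : Formula → Formula

_⇒f_ : Formula → Formula → Formula
A ⇒f B = (¬f A) ∨f B

⊤f : Formula
⊤f = ⊥f ⇒f ⊥f

Valuation : Set
Valuation = ℕ → Bool

eval : Valuation → Formula → Bool
eval v (atom p) = v p
eval v ⊥f = false
eval v (A ∧f B) = eval v A ∧ eval v B
eval v (A ∨f B) = eval v A ∨ eval v B
eval v (¬f A) = not (eval v A)

Valid : Formula → Set
Valid A = ∀ (v : Valuation) → eval v A ≡ true

_≅_ : Formula → Formula → Set
A ≅ B = ∀ (v : Valuation) → eval v A ≡ eval v B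

atoms : Formula → List ℕ
atoms (atom p) = p ∷ []
atoms ⊥f = []
atoms (A ∧f B) = atoms A ++ atoms B
atoms (A ∨f B) = atoms A ++ atoms B
atoms (¬f A) = atoms A

Interpolant : Formula → Formula → Formula → Set
Interpolant A B C =
  (∀ p → p ∈ atoms C → (p ∈ atoms A × p ∈ atoms B))
  × Valid (A ⇒f C) × Valid (C ⇒f B)

-- Split sequents Γ₁;Γ₂ ⇒ Δ₁;Δ₂ (multisets represented as lists,
-- with an explicit exchange/permutation rule below).
record SplitSeq : Set where
  constructor _︔_⇒_︔_
  field
    Γ₁ Γ₂ Δ₁ Δ₂ : List Formula

data Side : Set where
  left right : Side

addL : Side → Formula → SplitSeq → SplitSeq
addL left  A (g1 ︔ g2 ⇒ d1 ︔ d2) = (A ∷ g1) ︔ g2 ⇒ d1 ︔ d2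
addL right A (g1 ︔ g2 ⇒ d1 ︔ d2) = g1 ︔ (A ∷ g2) ⇒ d1 ︔ d2

addR : Side → Formula → SplitSeq → SplitSeq
addR left  A (g1 ︔ g2 ⇒ d1 ︔ d2) = g1 ︔ g2 ⇒ (A ∷ d1) ︔ d2
addR right A (g1 ︔ g2 ⇒ d1 ︔ d2) = g1 ︔ g2 ⇒ d1 ︔ (A ∷ d2)

data LK⁻ : SplitSeq → Set where
  ax-ll  : ∀ p → LK⁻ ((atom p ∷ []) ︔ [] ⇒ (atom p ∷ []) ︔ [])
  ax-rr  : ∀ p → LK⁻ ([] ︔ (atom p ∷ []) ⇒ [] ︔ (atom p ∷ []))
  ax-lr  : ∀ p → LK⁻ ((atom p ∷ []) ︔ [] ⇒ [] ︔ (atom p ∷ []))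
  ax-rl  : ∀ p → LK⁻ ([] ︔ (atom p ∷ []) ⇒ (atom p ∷ []) ︔ [])
  ax⊥-l  : LK⁻ ((⊥f ∷ []) ︔ [] ⇒ [] ︔ [])
  ax⊥-r  : LK⁻ ([] ︔ (⊥f ∷ []) ⇒ [] ︔ [])
  exch   : ∀ {g1 g2 d1 d2 g1' g2' d1' d2'} →
           g1 ↭ g1' → g2 ↭ g2' → d1 ↭ d1' → d2 ↭ d2' →
           LK⁻ (g1 ︔ g2 ⇒ d1 ︔ d2) → LK⁻ (g1' ︔ g2' ⇒ d1' ︔ d2')
  wL     : ∀ s A {S} → LK⁻ S → LK⁻ (addL s A S)
  wR     : ∀ s A {S} → LK⁻ S → LK⁻ (addR s A S)
  cL     : ∀ s A {S} → LK⁻ (addL s A (addL s A S)) → LK⁻ (addL s A S)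
  cR     : ∀ s A {S} → LK⁻ (addR s A (addR s A S)) → LK⁻ (addR s A S)
  ∧L₁    : ∀ s A B {S} → LK⁻ (addL s A S) → LK⁻ (addL s (A ∧f B) S)
  ∧L₂    : ∀ s A B {S} → LK⁻ (addL s B S) → LK⁻ (addL s (A ∧f B) S)
  ∧R     : ∀ s A B {S} → LK⁻ (addR s A S) → LK⁻ (addR s B S) →
           LK⁻ (addR s (A ∧f B) S)
  ∨R₁    : ∀ s A B {S} → LK⁻ (addR s A S) → LK⁻ (addR s (A ∨f B) S)
  ∨R₂    : ∀ s A B {S} → LK⁻ (addR s B S) → LK⁻ (addR s (A ∨f B) S)
  ∨L     : ∀ s A B {S} → LK⁻ (addL s A S) → LK⁻ (addL s B S) →
           LK⁻ (addL s (A ∨f B) S)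
  ¬L     : ∀ s A {S} → LK⁻ (addR s A S) → LK⁻ (addL s (¬f A) S)
  ¬R     : ∀ s A {S} → LK⁻ (addL s A S) → LK⁻ (addR s (¬f A) S)

combine : Side → Formula → Formula → Formula
combine left  C D = C ∨f D
combine right C D = C ∧f D

M : ∀ {S} → LK⁻ S → Formula
M (ax-ll p) = ⊥f
M (ax-rr p) = ⊤f
M (ax-lr p) = atom p
M (ax-rl p) = ¬f (atom p)
M ax⊥-l = ⊥f
M ax⊥-r = ⊤f
M (exch _ _ _ _ π) = M π
M (wL s A π) = M π
M (wR s A π) = M π
M (cL s A π) = M π
M (cR s A π) = M π
M (∧L₁ s A B π) = M π
M (∧L₂ s A B π) = M π
M (∧R s A B π₁ π₂) = combine s (M π₁) (M π₂)
M (∨R₁ s A B π) = M π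
M (∨R₂ s A B π) = M π
M (∨L s A B π₁ π₂) = combine s (M π₁) (M π₂)
M (¬L s A π) = M π
M (¬R s A π) = M π

-- In a cut-free proof of A;⇒;B every formula is a subformula of A or B and
-- stays on its side.  If A and B are negation-free, the left side therefore
-- only ever has antecedent formulas and the right side only succedent ones,
-- so the axiom ;p⇒p; (the only source of ¬ in the Maehara interpolant) never
-- occurs: the interpolant is negation-free, hence monotone in the valuation.
-- But the interpolant (p∧q∧r) ∨ (p∧¬q∧¬r) of p∧q∧r → p∨q∨r is not monotone.
module Submission where

open import Defs
open import Data.Bool using (true; false; _∧_; _∨_; _≤_; f≤t; b≤b)
open import Data.Bool.Properties using (≤-minimum; ≤-maximum)
open import Data.List using ([]; _∷_)
open import Data.List.Membership.Propositional using (_∈_)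
open import Data.List.Membership.Propositional.Properties using (∈-++⁻)
open import Data.List.Relation.Binary.Permutation.Propositional using (_↭_; ↭-sym)
open import Data.List.Relation.Binary.Permutation.Propositional.Properties
  using (↭-empty-inv; All-resp-↭)
open import Data.List.Relation.Unary.All using (All; []; _∷_)
open import Data.Nat using (suc)
open import Data.Product using (Σ-syntax; ∃₂; _×_; _,_)
open import Data.Sum using ([_,_]′)
open import Function using (id)
open import Relation.Binary.PropositionalEquality using (_≡_; refl; trans; subst₂)
open import Relation.Nullary using (¬_)

data NegationFree : Formula → Set where
  atom : ∀ p → NegationFree (atom p)
  ⊥f   : NegationFree ⊥f
  _∧f_ : ∀ {A B} → NegationFree A → NegationFree B → NegationFree (A ∧f B)
  _∨f_ : ∀ {A B} → NegationFree A → NegationFree B → NegationFree (A ∨f B)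

_≤ᵛ_ : Valuation → Valuation → Set
v ≤ᵛ w = ∀ n → v n ≤ w n

NonMonotone : Formula → Set
NonMonotone C = ∃₂ λ v w → v ≤ᵛ w × eval v C ≡ true × eval w C ≡ false

∧-mono-≤ : ∀ {a b c d} → a ≤ b → c ≤ d → a ∧ c ≤ b ∧ d
∧-mono-≤ f≤t           _   = ≤-minimum _
∧-mono-≤ (b≤b {false}) _   = b≤b
∧-mono-≤ (b≤b {true})  c≤d = c≤d

∨-mono-≤ : ∀ {a b c d} → a ≤ b → c ≤ d → a ∨ c ≤ b ∨ d
∨-mono-≤ f≤t           _   = ≤-maximum _
∨-mono-≤ (b≤b {false}) c≤d = c≤d
∨-mono-≤ (b≤b {true})  _   = b≤b

eval-mono : ∀ {v w F} → v ≤ᵛ w → NegationFree F → eval v F ≤ eval w F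
eval-mono v≤w (atom p) = v≤w p
eval-mono v≤w ⊥f       = b≤b
eval-mono v≤w (A ∧f B) = ∧-mono-≤ (eval-mono v≤w A) (eval-mono v≤w B)
eval-mono v≤w (A ∨f B) = ∨-mono-≤ (eval-mono v≤w A) (eval-mono v≤w B)

negationFree-≇-nonMonotone : ∀ {F C} → NegationFree F → NonMonotone C → ¬ (F ≅ C)
negationFree-≇-nonMonotone nf (v , w , v≤w , Cv , Cw) F≅C
  with subst₂ _≤_ (trans (F≅C v) Cv) (trans (F≅C w) Cw) (eval-mono v≤w nf)
... | ()

-- The shape of every sequent in a proof of A;⇒;B with A, B negation-free.
Positive : SplitSeq → Set
Positive (Γ₁ ︔ Γ₂ ⇒ Δ₁ ︔ Δ₂) = All NegationFree Γ₁ × Γ₂ ≡ [] × Δ₁ ≡ [] × All NegationFree Δ₂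

positive-addL⁻ : ∀ s X S → Positive (addL s X S) → s ≡ left × NegationFree X × Positive S
positive-addL⁻ left  X S (X⁺ ∷ Γ₁⁺ , Γ₂⁺ , Δ₁⁺ , Δ₂⁺) = refl , X⁺ , (Γ₁⁺ , Γ₂⁺ , Δ₁⁺ , Δ₂⁺)
positive-addL⁻ right X S (_ , () , _ , _)

positive-addL⁺ : ∀ {X} S → NegationFree X → Positive S → Positive (addL left X S)
positive-addL⁺ S X⁺ (Γ₁⁺ , Γ₂⁺ , Δ₁⁺ , Δ₂⁺) = X⁺ ∷ Γ₁⁺ , Γ₂⁺ , Δ₁⁺ , Δ₂⁺

positive-addR⁻ : ∀ s X S → Positive (addR s X S) → s ≡ right × NegationFree X × Positive S
positive-addR⁻ right X S (Γ₁⁺ , Γ₂⁺ , Δ₁⁺ , X⁺ ∷ Δ₂⁺) = refl , X⁺ , (Γ₁⁺ , Γ₂⁺ , Δ₁⁺ , Δ₂⁺)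
positive-addR⁻ left  X S (_ , _ , () , _)

positive-addR⁺ : ∀ {X} S → NegationFree X → Positive S → Positive (addR right X S)
positive-addR⁺ S X⁺ (Γ₁⁺ , Γ₂⁺ , Δ₁⁺ , Δ₂⁺) = Γ₁⁺ , Γ₂⁺ , Δ₁⁺ , X⁺ ∷ Δ₂⁺

positive-resp-↭ : ∀ {Γ₁ Γ₂ Δ₁ Δ₂ Γ₁′ Γ₂′ Δ₁′ Δ₂′} →
  Γ₁ ↭ Γ₁′ → Γ₂ ↭ Γ₂′ → Δ₁ ↭ Δ₁′ → Δ₂ ↭ Δ₂′ →
  Positive (Γ₁′ ︔ Γ₂′ ⇒ Δ₁′ ︔ Δ₂′) → Positive (Γ₁ ︔ Γ₂ ⇒ Δ₁ ︔ Δ₂)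
positive-resp-↭ p₁ p₂ p₃ p₄ (Γ₁⁺ , refl , refl , Δ₂⁺) =
  All-resp-↭ (↭-sym p₁) Γ₁⁺ , ↭-empty-inv p₂ , ↭-empty-inv p₃ , All-resp-↭ (↭-sym p₄) Δ₂⁺

M-negationFree : ∀ {S} (π : LK⁻ S) → Positive S → NegationFree (M π)
M-negationFree (ax-ll p) (_ , _ , () , _)
M-negationFree (ax-rr p) (_ , () , _ , _)
M-negationFree (ax-lr p) _ = atom p
M-negationFree (ax-rl p) (_ , () , _ , _)
M-negationFree ax⊥-l _ = ⊥f
M-negationFree ax⊥-r (_ , () , _ , _)
M-negationFree (exch p₁ p₂ p₃ p₄ π) S⁺ = M-negationFree π (positive-resp-↭ p₁ p₂ p₃ p₄ S⁺)
M-negationFree (wL s A {S} π) S⁺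
  with refl , _ , S⁺ ← positive-addL⁻ s A S S⁺ = M-negationFree π S⁺
M-negationFree (wR s A {S} π) S⁺
  with refl , _ , S⁺ ← positive-addR⁻ s A S S⁺ = M-negationFree π S⁺
M-negationFree (cL s A {S} π) S⁺
  with refl , A⁺ , S⁺ ← positive-addL⁻ s A S S⁺ =
  M-negationFree π (positive-addL⁺ _ A⁺ (positive-addL⁺ S A⁺ S⁺))
M-negationFree (cR s A {S} π) S⁺
  with refl , A⁺ , S⁺ ← positive-addR⁻ s A S S⁺ =
  M-negationFree π (positive-addR⁺ _ A⁺ (positive-addR⁺ S A⁺ S⁺))
M-negationFree (∧L₁ s A B {S} π) S⁺
  with refl , A⁺ ∧f _ , S⁺ ← positive-addL⁻ s (A ∧f B) S S⁺ =
  M-negationFree π (positive-addL⁺ S A⁺ S⁺)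
M-negationFree (∧L₂ s A B {S} π) S⁺
  with refl , _ ∧f B⁺ , S⁺ ← positive-addL⁻ s (A ∧f B) S S⁺ =
  M-negationFree π (positive-addL⁺ S B⁺ S⁺)
M-negationFree (∧R s A B {S} π₁ π₂) S⁺
  with refl , A⁺ ∧f B⁺ , S⁺ ← positive-addR⁻ s (A ∧f B) S S⁺ =
  M-negationFree π₁ (positive-addR⁺ S A⁺ S⁺) ∧f M-negationFree π₂ (positive-addR⁺ S B⁺ S⁺)
M-negationFree (∨R₁ s A B {S} π) S⁺
  with refl , A⁺ ∨f _ , S⁺ ← positive-addR⁻ s (A ∨f B) S S⁺ =
  M-negationFree π (positive-addR⁺ S A⁺ S⁺)
M-negationFree (∨R₂ s A B {S} π) S⁺
  with refl , _ ∨f B⁺ , S⁺ ← positive-addR⁻ s (A ∨f B) S S⁺ =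
  M-negationFree π (positive-addR⁺ S B⁺ S⁺)
M-negationFree (∨L s A B {S} π₁ π₂) S⁺
  with refl , A⁺ ∨f B⁺ , S⁺ ← positive-addL⁻ s (A ∨f B) S S⁺ =
  M-negationFree π₁ (positive-addL⁺ S A⁺ S⁺) ∨f M-negationFree π₂ (positive-addL⁺ S B⁺ S⁺)
M-negationFree (¬L s A {S} π) S⁺ with positive-addL⁻ s (¬f A) S S⁺
... | _ , () , _
M-negationFree (¬R s A {S} π) S⁺ with positive-addR⁻ s (¬f A) S S⁺
... | _ , () , _

maehara-≇-nonMonotone : ∀ {A B C} → NegationFree A → NegationFree B → NonMonotone C →
  (π : LK⁻ ((A ∷ []) ︔ [] ⇒ [] ︔ (B ∷ []))) → ¬ (M π ≅ C)
maehara-≇-nonMonotone {C = C} A⁺ B⁺ C± π =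
  negationFree-≇-nonMonotone {C = C} (M-negationFree π (A⁺ ∷ [] , refl , refl , B⁺ ∷ [])) C±

p q r : Formula
p = atom 0
q = atom 1
r = atom 2

A B C : Formula
A = p ∧f (q ∧f r)
B = p ∨f (q ∨f r)
C = A ∨f (p ∧f ((¬f q) ∧f (¬f r)))

A⁺ : NegationFree A
A⁺ = atom 0 ∧f (atom 1 ∧f atom 2)

B⁺ : NegationFree B
B⁺ = atom 0 ∨f (atom 1 ∨f atom 2)

C-nonMonotone : NonMonotone C
C-nonMonotone = only-p , only-pq , only-p≤only-pq , refl , refl
  where
  only-p only-pq : Valuation
  only-p 0 = true
  only-p _ = false
  only-pq 0 = true
  only-pq 1 = true
  only-pq _ = false

  only-p≤only-pq : only-p ≤ᵛ only-pq
  only-p≤only-pq 0             = b≤b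
  only-p≤only-pq 1             = f≤t
  only-p≤only-pq (suc (suc n)) = b≤b

A⇒B-valid : Valid (A ⇒f B)
A⇒B-valid v with v 0 | v 1 | v 2
... | false | _     | _     = refl
... | true  | false | _     = refl
... | true  | true  | false = refl
... | true  | true  | true  = refl

A⇒C-valid : Valid (A ⇒f C)
A⇒C-valid v with v 0 | v 1 | v 2
... | false | _     | _     = refl
... | true  | false | _     = refl
... | true  | true  | false = refl
... | true  | true  | true  = refl

C⇒B-valid : Valid (C ⇒f B)
C⇒B-valid v with v 0 | v 1 | v 2
... | false | _     | _     = refl
... | true  | true  | false = refl
... | true  | true  | true  = refl
... | true  | false | false = refl
... | true  | false | true  = refl

C-interpolant : Interpolant A B C
C-interpolant = atoms-C⊆A∩B , A⇒C-valid , C⇒B-valid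
  where
  -- atoms A, atoms B and both disjuncts of C all list exactly p, q, r.
  atoms-C⊆A∩B : ∀ n → n ∈ atoms C → n ∈ atoms A × n ∈ atoms B
  atoms-C⊆A∩B n n∈C = let n∈A = [ id , id ]′ (∈-++⁻ (atoms A) n∈C) in n∈A , n∈A

proposition3p5 : Σ[ A ∈ Formula ] Σ[ B ∈ Formula ] Σ[ C ∈ Formula ]
    (Valid (A ⇒f B) × Interpolant A B C
     × ((π : LK⁻ ((A ∷ []) ︔ [] ⇒ [] ︔ (B ∷ []))) → ¬ (M π ≅ C)))
proposition3p5 =
  A , B , C , A⇒B-valid , C-interpolant , maehara-≇-nonMonotone {C = C} A⁺ B⁺ C-nonMonotone
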